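{- Let $m$ and $M$ be positive integers such that $\rho (m,M) = 2$. Then $\min (m,M) \geq 6$, and if $\min (m,M)= 6$ then $\max(m,M)\geq 10$. Moreover, $\rho(6,10)=2$.
   Context: For positive integers $m,M$ define $\rho(m,M)=\min\{t\in\mathbb{Z}_{\ge 0} : \exists\, t'\in\mathbb{Z},\ 0\le t'\le t,\ \gcd(M-t',\,m-(t-t'))=1\}$. -}

module Defs where

open import Data.Nat using (ℕ; _≤_; _<_)
open import Data.Integer using (ℤ; +_; _-_)
open import Data.Integer.GCD using (gcd)
open import Data.Product using (Σ; _×_)
open import Relation.Binary.PropositionalEquality using (_≡_)
open import Relation.Nullary using (¬_)

Admissible : ℕ → ℕ → ℕ → Set
Admissible m M t =
  Σ ℕ λ t' → t' ≤ t × gcd (+ M - + t') (+ m - (+ t - + t')) ≡ + 1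

RhoIs : ℕ → ℕ → ℕ → Set
RhoIs m M t = Admissible m M t × (∀ s → s < t → ¬ Admissible m M s)

{-# OPTIONS --safe #-}
module Submission where

-- If ρ(m, M) ≥ 2 then gcd(M, m), gcd(M, m − 1) and gcd(M − 1, m) all exceed 1.
-- Every m ≤ 5 is 1 or a prime power, so it is coprime to one of the consecutive
-- numbers M − 1, M; hence m ≥ 6, and M ≥ 6 by the symmetry ρ(m, M) = ρ(M, m).
-- If m = 6 and 6 ≤ M ≤ 9 then 5 ∤ M, so gcd(M, 6 − 1) = 1 and ρ(6, M) ≤ 1.
-- For (6, 10) the three gcds are 2, 5, 3, while gcd(10 − 1, 6 − 1) = 1.

open import Defs
open import Data.Nat using (ℕ; suc; _+_; _*_; _∸_; _≤_; _<_; _≤?_; _%_; _/_; NonZero; _⊓_; _⊔_; z≤n; s≤s)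
open import Data.Nat.Properties
  using (_≟_; +-comm; ≤-refl; ≤-trans; ≤-pred; ≰⇒>; m∸n≤m; m∸[m∸n]≡n; ⊓-sel; ⊓-glb; m≤m⊔n; m≤n⊔m; allUpTo?)
open import Data.Nat.Divisibility using (_∣_; ∣-antisym; ∣-trans; ∣m∣n⇒∣m+n; ∣m+n∣m⇒∣n; n∣m*n)
open import Data.Nat.DivMod using (m≡m%n+[m/n]*n; m%n<n)
import Data.Nat.GCD as ℕ
open import Data.Integer using (+_; _-_; ∣_∣)
open import Data.Integer.Properties using ([+m]-[+n]≡m⊖n; ⊖-≥)
open import Data.Integer.GCD using (gcd)
open import Data.Product using (_×_; _,_; proj₂)
open import Data.Sum using (_⊎_; inj₁; inj₂)
open import Relation.Nullary using (¬_; yes; no; contradiction)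
open import Relation.Nullary.Decidable using (from-yes; _→-dec_; _⊎-dec_)
open import Relation.Binary.PropositionalEquality using (_≡_; refl; sym; trans; cong; cong₂; subst; module ≡-Reasoning)
open ≡-Reasoning

[+m]-[+n]≡+[m∸n] : ∀ {m n} → n ≤ m → + m - + n ≡ + (m ∸ n)
[+m]-[+n]≡+[m∸n] {m} {n} n≤m = trans ([+m]-[+n]≡m⊖n m n) (⊖-≥ n≤m)

gcd[m+k*n,n]≡gcd[m,n] : ∀ m k n → ℕ.gcd (m + k * n) n ≡ ℕ.gcd m n
gcd[m+k*n,n]≡gcd[m,n] m k n = ∣-antisym
  (ℕ.gcd-greatest (∣m+n∣m⇒∣n g∣k*n+m (∣-trans g∣n (n∣m*n k))) g∣n)
  (ℕ.gcd-greatest (∣m∣n⇒∣m+n (ℕ.gcd[m,n]∣m m n) (∣-trans (ℕ.gcd[m,n]∣n m n) (n∣m*n k))) (ℕ.gcd[m,n]∣n m n))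
  where
  g∣n : ℕ.gcd (m + k * n) n ∣ n
  g∣n = ℕ.gcd[m,n]∣n (m + k * n) n
  g∣k*n+m : ℕ.gcd (m + k * n) n ∣ k * n + m
  g∣k*n+m = subst (ℕ.gcd (m + k * n) n ∣_) (+-comm m (k * n)) (ℕ.gcd[m,n]∣m (m + k * n) n)

gcd[m%n,n]≡gcd[m,n] : ∀ m n .{{_ : NonZero n}} → ℕ.gcd (m % n) n ≡ ℕ.gcd m n
gcd[m%n,n]≡gcd[m,n] m n = begin
  ℕ.gcd (m % n) n               ≡⟨ gcd[m+k*n,n]≡gcd[m,n] (m % n) (m / n) n ⟨
  ℕ.gcd (m % n + m / n * n) n   ≡⟨ cong (λ x → ℕ.gcd x n) (m≡m%n+[m/n]*n m n) ⟨
  ℕ.gcd m n                     ∎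

gcd[1+m%n,n]≡gcd[1+m,n] : ∀ m n .{{_ : NonZero n}} → ℕ.gcd (suc (m % n)) n ≡ ℕ.gcd (suc m) n
gcd[1+m%n,n]≡gcd[1+m,n] m n = begin
  ℕ.gcd (suc (m % n)) n               ≡⟨ gcd[m+k*n,n]≡gcd[m,n] (suc (m % n)) (m / n) n ⟨
  ℕ.gcd (suc (m % n + m / n * n)) n   ≡⟨ cong (λ x → ℕ.gcd (suc x) n) (m≡m%n+[m/n]*n m n) ⟨
  ℕ.gcd (suc m) n                     ∎

gcd[r,k]≡1⊎gcd[1+r,k]≡1-for-k<6 : ∀ {k} → k < 6 → ∀ {r} → r < k → ℕ.gcd r k ≡ 1 ⊎ ℕ.gcd (suc r) k ≡ 1
gcd[r,k]≡1⊎gcd[1+r,k]≡1-for-k<6 = from-yes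
  (allUpTo? (λ k → allUpTo? (λ r → ℕ.gcd r k ≟ 1 ⊎-dec ℕ.gcd (suc r) k ≟ 1) k) 6)

gcd[n,k]≡1⊎gcd[1+n,k]≡1 : ∀ {k} .{{_ : NonZero k}} → k ≤ 5 → ∀ n → ℕ.gcd n k ≡ 1 ⊎ ℕ.gcd (suc n) k ≡ 1
gcd[n,k]≡1⊎gcd[1+n,k]≡1 {k} k≤5 n with gcd[r,k]≡1⊎gcd[1+r,k]≡1-for-k<6 (s≤s k≤5) (m%n<n n k)
... | inj₁ gcd≡1 = inj₁ (trans (sym (gcd[m%n,n]≡gcd[m,n] n k)) gcd≡1)
... | inj₂ gcd≡1 = inj₂ (trans (sym (gcd[1+m%n,n]≡gcd[1+m,n] n k)) gcd≡1)

admissible-from-gcd : ∀ {m M t} t′ → t′ ≤ t → t′ ≤ M → t ∸ t′ ≤ m →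
                      ℕ.gcd (M ∸ t′) (m ∸ (t ∸ t′)) ≡ 1 → Admissible m M t
admissible-from-gcd {m} {M} {t} t′ t′≤t t′≤M t-t′≤m gcd≡1 = t′ , t′≤t , (begin
  gcd (+ M - + t′) (+ m - (+ t - + t′))  ≡⟨ cong (λ x → gcd (+ M - + t′) (+ m - x)) ([+m]-[+n]≡+[m∸n] t′≤t) ⟩
  gcd (+ M - + t′) (+ m - + (t ∸ t′))    ≡⟨ cong₂ gcd ([+m]-[+n]≡+[m∸n] t′≤M) ([+m]-[+n]≡+[m∸n] t-t′≤m) ⟩
  + ℕ.gcd (M ∸ t′) (m ∸ (t ∸ t′))        ≡⟨ cong +_ gcd≡1 ⟩
  + 1                                    ∎)

admissible-sym : ∀ {m M t} → Admissible m M t → Admissible M m t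
admissible-sym {m} {M} {t} (t′ , t′≤t , gcd≡1) = t ∸ t′ , m∸n≤m t t′ , (begin
  gcd (+ m - + (t ∸ t′)) (+ M - (+ t - + (t ∸ t′)))  ≡⟨ cong₂ (λ x y → gcd (+ m - x) (+ M - y)) t-t′ t-[t-t′] ⟩
  gcd (+ m - (+ t - + t′)) (+ M - + t′)              ≡⟨ cong +_ (ℕ.gcd-comm ∣ + m - (+ t - + t′) ∣ ∣ + M - + t′ ∣) ⟩
  gcd (+ M - + t′) (+ m - (+ t - + t′))              ≡⟨ gcd≡1 ⟩
  + 1                                                ∎)
  where
  t-t′ : + (t ∸ t′) ≡ + t - + t′
  t-t′ = sym ([+m]-[+n]≡+[m∸n] t′≤t)
  t-[t-t′] : + t - + (t ∸ t′) ≡ + t′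
  t-[t-t′] = trans ([+m]-[+n]≡+[m∸n] (m∸n≤m t t′)) (cong +_ (m∸[m∸n]≡n t′≤t))

rhoIs-sym : ∀ {m M t} → RhoIs m M t → RhoIs M m t
rhoIs-sym (adm , minimal) = admissible-sym adm , λ s s<t adm′ → minimal s s<t (admissible-sym adm′)

2≤ρ⇒6≤m : ∀ {m M t} .{{_ : NonZero m}} .{{_ : NonZero M}} → 2 ≤ t → RhoIs m M t → 6 ≤ m
2≤ρ⇒6≤m {suc m} {suc M} 2≤t (_ , minimal) with 6 ≤? suc m
... | yes 6≤m = 6≤m
... | no 6≰m with gcd[n,k]≡1⊎gcd[1+n,k]≡1 (≤-pred (≰⇒> 6≰m)) M
... | inj₁ gcd≡1 = contradiction (admissible-from-gcd 1 ≤-refl (s≤s z≤n) z≤n gcd≡1) (minimal 1 2≤t)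
... | inj₂ gcd≡1 = contradiction (admissible-from-gcd 0 z≤n z≤n z≤n gcd≡1) (minimal 0 (≤-trans (s≤s z≤n) 2≤t))

gcd[M,5]≡1-for-6≤M<10 : ∀ {M} → M < 10 → 6 ≤ M → ℕ.gcd M 5 ≡ 1
gcd[M,5]≡1-for-6≤M<10 = from-yes (allUpTo? (λ M → 6 ≤? M →-dec ℕ.gcd M 5 ≟ 1) 10)

2≤ρ[6,M]⇒10≤M : ∀ {M t} .{{_ : NonZero M}} → 2 ≤ t → RhoIs 6 M t → 10 ≤ M
2≤ρ[6,M]⇒10≤M {M} 2≤t ρ with 10 ≤? M
... | yes 10≤M = 10≤M
... | no 10≰M = contradiction (admissible-from-gcd 0 z≤n z≤n (s≤s z≤n) gcd[M,5]≡1) (proj₂ ρ 1 2≤t)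
  where
  gcd[M,5]≡1 : ℕ.gcd M 5 ≡ 1
  gcd[M,5]≡1 = gcd[M,5]≡1-for-6≤M<10 (≰⇒> 10≰M) (2≤ρ⇒6≤m 2≤t (rhoIs-sym ρ))

ρ[6,10]≡2 : RhoIs 6 10 2
ρ[6,10]≡2 = admissible-from-gcd 1 (s≤s z≤n) (s≤s z≤n) (s≤s z≤n) refl , not-admissible
  where
  not-admissible : ∀ s → s < 2 → ¬ Admissible 6 10 s
  not-admissible 0 _ (0 , z≤n , ())
  not-admissible 1 _ (0 , z≤n , ())
  not-admissible 1 _ (1 , s≤s z≤n , ())
  not-admissible 0 _ (suc _ , () , _)
  not-admissible 1 _ (suc (suc _) , s≤s () , _)
  not-admissible (suc (suc _)) (s≤s (s≤s ())) _

lemma4p1 : ((m M : ℕ) → .{{NonZero m}} → .{{NonZero M}} → RhoIs m M 2 →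
               (6 ≤ m ⊓ M) × (m ⊓ M ≡ 6 → 10 ≤ m ⊔ M))
             × RhoIs 6 10 2
lemma4p1 = bounds , ρ[6,10]≡2
  where
  bounds : (m M : ℕ) → .{{NonZero m}} → .{{NonZero M}} → RhoIs m M 2 →
           (6 ≤ m ⊓ M) × (m ⊓ M ≡ 6 → 10 ≤ m ⊔ M)
  bounds m M ρ = ⊓-glb (2≤ρ⇒6≤m ≤-refl ρ) (2≤ρ⇒6≤m ≤-refl (rhoIs-sym ρ)) , 10≤max
    where
    10≤max : m ⊓ M ≡ 6 → 10 ≤ m ⊔ M
    10≤max min≡6 with ⊓-sel m M
    ... | inj₁ min≡m = ≤-trans (2≤ρ[6,M]⇒10≤M ≤-refl ρ[6,M]) (m≤n⊔m m M)
      where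
      ρ[6,M] : RhoIs 6 M 2
      ρ[6,M] = subst (λ x → RhoIs x M 2) (trans (sym min≡m) min≡6) ρ
    ... | inj₂ min≡M = ≤-trans (2≤ρ[6,M]⇒10≤M ≤-refl ρ[6,m]) (m≤m⊔n m M)
      where
      ρ[6,m] : RhoIs 6 m 2
      ρ[6,m] = subst (λ x → RhoIs x m 2) (trans (sym min≡M) min≡6) (rhoIs-sym ρ)
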